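{- Let $m \geq 2$ and $n \geq 2$ be integers. The $m \times n$ grid of cells can be partitioned into axis-parallel rectangular blocks of cells, each of size $2 \times 2$, $2 \times 3$, $3 \times 2$, or $3 \times 3$. -}

module Defs where

open import Data.Nat using (ℕ; _+_; _≤_; _<_)
open import Data.Fin using (Fin; toℕ)
open import Data.List using (List; length; lookup)
open import Data.Product using (_×_; Σ; _,_)
open import Relation.Binary.PropositionalEquality using (_≡_)

data Side : ℕ → Set where
  two   : Side 2
  three : Side 3

-- An axis-parallel rectangular block of cells: rows row .. row+height-1,
-- columns col .. col+width-1 (0-indexed), with height, width ∈ {2,3}.
record Block : Set where
  constructor block
  field
    row    : ℕ
    col    : ℕ
    height : ℕ
    width  : ℕ
    height-ok : Side height
    width-ok  : Side width
open Block public

_∋ᶜ_ : Block → ℕ × ℕ → Set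
b ∋ᶜ (i , j) =
  (row b ≤ i × i < row b + height b) × (col b ≤ j × j < col b + width b)

InGrid : ℕ → ℕ → Block → Set
InGrid m n b = (row b + height b ≤ m) × (col b + width b ≤ n)

Partition : ℕ → ℕ → List Block → Set
Partition m n bs =
  ((k : Fin (length bs)) → InGrid m n (lookup bs k)) ×
  ((i : Fin m) (j : Fin n) →
     Σ (Fin (length bs)) λ k →
       (lookup bs k ∋ᶜ (toℕ i , toℕ j)) ×
       ((k′ : Fin (length bs)) → lookup bs k′ ∋ᶜ (toℕ i , toℕ j) → k′ ≡ k))

-- Cut each side into consecutive segments of lengths 2 and 3 (possible for any length ≥ 2:
-- peel off 2 until 2 or 3 is left); the products of a row segment with a column segment
-- then partition the grid, because every row and every column index lies in exactly one
-- segment of its side.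
module Submission where

open import Defs
open import Data.Nat using (ℕ; suc; _+_; _≤_; _<_; z≤n; s≤s)
open import Data.Nat.Properties using (≤-refl; ≤-reflexive; ≤-trans; +-monoʳ-≤; m≤m+n; +-assoc; <⇒≱; <-≤-connex)
open import Data.List using (List; []; _∷_; _++_; map; length; lookup; cartesianProductWith)
open import Data.List.Relation.Unary.All as All using (All; []; _∷_)
open import Data.List.Relation.Unary.All.Properties using (++⁺; map⁺; cartesianProductWith⁺)
open import Data.List.Membership.Propositional.Properties using (∈-lookup)
open import Data.Fin using (Fin; toℕ) renaming (zero to fzero; suc to fsuc)
open import Data.Fin.Properties using (toℕ<n)
open import Data.Product using (Σ; _×_; _,_; proj₁; proj₂)
open import Data.Sum using (inj₁; inj₂)
open import Data.Empty using (⊥-elim)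
open import Function using (id)
open import Relation.Nullary using (¬_)
open import Relation.Unary using (∁)
open import Relation.Binary.PropositionalEquality using (_≡_; refl; cong; subst; sym; setoid)

data ExactlyOne {A : Set} (P : A → Set) : List A → Set where
  here  : ∀ {x xs} → P x → All (∁ P) xs → ExactlyOne P (x ∷ xs)
  there : ∀ {x xs} → ¬ P x → ExactlyOne P xs → ExactlyOne P (x ∷ xs)

module _ {A : Set} {P : A → Set} where

  exactlyOne-++⁺ˡ : ∀ {xs ys} → ExactlyOne P xs → All (∁ P) ys → ExactlyOne P (xs ++ ys)
  exactlyOne-++⁺ˡ (here px ¬pxs) ¬pys = here px (++⁺ ¬pxs ¬pys)
  exactlyOne-++⁺ˡ (there ¬px one) ¬pys = there ¬px (exactlyOne-++⁺ˡ one ¬pys)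

  exactlyOne-++⁺ʳ : ∀ {xs ys} → All (∁ P) xs → ExactlyOne P ys → ExactlyOne P (xs ++ ys)
  exactlyOne-++⁺ʳ [] one = one
  exactlyOne-++⁺ʳ (¬px ∷ ¬pxs) one = there ¬px (exactlyOne-++⁺ʳ ¬pxs one)

  exactlyOne⇒uniqueIndex : ∀ {xs} → ExactlyOne P xs →
    Σ (Fin (length xs)) λ k → P (lookup xs k) × ((k′ : Fin (length xs)) → P (lookup xs k′) → k′ ≡ k)
  exactlyOne⇒uniqueIndex {x ∷ xs} (here px ¬pxs) = fzero , px , unique
    where
    unique : ∀ k′ → P (lookup (x ∷ xs) k′) → k′ ≡ fzero
    unique fzero      _  = refl
    unique (fsuc k′) pk′ = ⊥-elim (All.lookup ¬pxs (∈-lookup k′) pk′)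
  exactlyOne⇒uniqueIndex {x ∷ xs} (there ¬px one) with exactlyOne⇒uniqueIndex one
  ... | k , pk , unique = fsuc k , pk , unique′
    where
    unique′ : ∀ k′ → P (lookup (x ∷ xs) k′) → k′ ≡ fsuc k
    unique′ fzero      px  = ⊥-elim (¬px px)
    unique′ (fsuc k′) pk′ = cong fsuc (unique k′ pk′)

exactlyOne-map : ∀ {A : Set} {P Q : A → Set} → (∀ {x} → P x → Q x) → (∀ {x} → Q x → P x) →
                 ∀ {xs} → ExactlyOne P xs → ExactlyOne Q xs
exactlyOne-map P⇒Q Q⇒P (here px ¬pxs) = here (P⇒Q px) (All.map (λ ¬px qx → ¬px (Q⇒P qx)) ¬pxs)
exactlyOne-map P⇒Q Q⇒P (there ¬px one) = there (λ qx → ¬px (Q⇒P qx)) (exactlyOne-map P⇒Q Q⇒P one)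

exactlyOne-map⁺ : ∀ {A B : Set} {P : B → Set} {f : A → B} {xs} →
                  ExactlyOne (λ x → P (f x)) xs → ExactlyOne P (map f xs)
exactlyOne-map⁺ (here px ¬pxs) = here px (map⁺ ¬pxs)
exactlyOne-map⁺ (there ¬px one) = there ¬px (exactlyOne-map⁺ one)

module _ {A B C : Set} (f : A → B → C) {P : A → Set} {Q : B → Set} {R : C → Set}
         (intro : ∀ {x y} → P x → Q y → R (f x y))
         (elim : ∀ {x y} → R (f x y) → P x × Q y) where

  outside-row : ∀ {x} → ¬ P x → ∀ ys → All (∁ R) (map (f x) ys)
  outside-row ¬px ys = map⁺ (All.universal (λ _ r → ¬px (proj₁ (elim r))) ys)

  outside-rows : ∀ {xs} → All (∁ P) xs → ∀ ys → All (∁ R) (cartesianProductWith f xs ys)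
  outside-rows [] ys = []
  outside-rows (¬px ∷ ¬pxs) ys = ++⁺ (outside-row ¬px ys) (outside-rows ¬pxs ys)

  exactlyOne-cartesianProductWith⁺ : ∀ {xs ys} → ExactlyOne P xs → ExactlyOne Q ys →
                                     ExactlyOne R (cartesianProductWith f xs ys)
  exactlyOne-cartesianProductWith⁺ {ys = ys} (here px ¬pxs) oneQ =
    exactlyOne-++⁺ˡ (exactlyOne-map⁺ (exactlyOne-map (intro px) (λ r → proj₂ (elim r)) oneQ))
                    (outside-rows ¬pxs ys)
  exactlyOne-cartesianProductWith⁺ {ys = ys} (there ¬px oneP) oneQ =
    exactlyOne-++⁺ʳ (outside-row ¬px ys) (exactlyOne-cartesianProductWith⁺ oneP oneQ)

record Segment : Set where
  constructor segment
  field
    start   : ℕ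
    size    : ℕ
    size-ok : Side size
open Segment

_∋ˢ_ : Segment → ℕ → Set
s ∋ˢ j = start s ≤ j × j < start s + size s

Within : ℕ → ℕ → Segment → Set
Within a k s = a ≤ start s × start s + size s ≤ a + k

tiling : ℕ → ℕ → List Segment
tiling a 0 = []
tiling a 1 = []
tiling a 2 = segment a 2 two ∷ []
tiling a 3 = segment a 3 three ∷ []
tiling a (suc (suc (suc (suc k)))) = segment a 2 two ∷ tiling (a + 2) (suc (suc k))

tiling-within : ∀ a k → All (Within a k) (tiling a k)
tiling-within a 0 = []
tiling-within a 1 = []
tiling-within a 2 = (≤-refl , ≤-refl) ∷ []
tiling-within a 3 = (≤-refl , ≤-refl) ∷ []
tiling-within a (suc (suc (suc (suc k)))) =
  (≤-refl , +-monoʳ-≤ a (s≤s (s≤s z≤n))) ∷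
  All.map (λ (a+2≤ , ≤a+2+k) → ≤-trans (m≤m+n a 2) a+2≤ ,
                                ≤-trans ≤a+2+k (≤-reflexive (+-assoc a 2 (2 + k))))
          (tiling-within (a + 2) (suc (suc k)))

tiling-∌-below : ∀ a k {j} → j < a → All (∁ (_∋ˢ j)) (tiling a k)
tiling-∌-below a k j<a =
  All.map (λ (a≤ , _) (≤j , _) → <⇒≱ j<a (≤-trans a≤ ≤j)) (tiling-within a k)

tiling-exactlyOne : ∀ {a k j} → 2 ≤ k → a ≤ j → j < a + k → ExactlyOne (_∋ˢ j) (tiling a k)
tiling-exactlyOne (s≤s (s≤s _)) = go _
  where
  go : ∀ k {a j} → a ≤ j → j < a + (2 + k) → ExactlyOne (_∋ˢ j) (tiling a (2 + k))
  go 0 a≤j j<a+k = here (a≤j , j<a+k) []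
  go 1 a≤j j<a+k = here (a≤j , j<a+k) []
  go (suc (suc k)) {a} {j} a≤j j<a+k with <-≤-connex j (a + 2)
  ... | inj₁ j<a+2 = here (a≤j , j<a+2) (tiling-∌-below (a + 2) (2 + k) j<a+2)
  ... | inj₂ a+2≤j = there (λ s∋j → <⇒≱ (proj₂ s∋j) a+2≤j)
    (go k a+2≤j (subst (j <_) (sym (+-assoc a 2 (2 + k))) j<a+k))

toBlock : Segment → Segment → Block
toBlock r c = block (start r) (start c) (size r) (size c) (size-ok r) (size-ok c)

lemma6 : (m n : ℕ) → 2 ≤ m → 2 ≤ n → Σ (List Block) (λ bs → Partition m n bs)
lemma6 m n 2≤m 2≤n = blocks , inGrid , covered
  where
  blocks : List Block
  blocks = cartesianProductWith toBlock (tiling 0 m) (tiling 0 n)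

  inGrid : (k : Fin (length blocks)) → InGrid m n (lookup blocks k)
  inGrid k = All.lookup
    (cartesianProductWith⁺ (setoid Segment) (setoid Segment) toBlock (tiling 0 m) (tiling 0 n)
       (λ r∈ c∈ → proj₂ (All.lookup (tiling-within 0 m) r∈) , proj₂ (All.lookup (tiling-within 0 n) c∈)))
    (∈-lookup k)

  covered : (i : Fin m) (j : Fin n) → Σ (Fin (length blocks)) λ k →
              (lookup blocks k ∋ᶜ (toℕ i , toℕ j)) ×
              ((k′ : Fin (length blocks)) → lookup blocks k′ ∋ᶜ (toℕ i , toℕ j) → k′ ≡ k)
  covered i j = exactlyOne⇒uniqueIndex
    (exactlyOne-cartesianProductWith⁺ toBlock _,_ id
       (tiling-exactlyOne 2≤m z≤n (toℕ<n i)) (tiling-exactlyOne 2≤n z≤n (toℕ<n j)))
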